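{- For every type $\tau\in\mathcal{T}$ of $\mathrm{PRED2}_0$ and every finite set of formulas $\Delta$ of $\mathrm{PRED2}_0$, there exists a term $t$ such that $\Gamma(\Delta)\vdash_{\mathcal{I}_0}A_\tau t$.
   Context: $\mathrm{PRED2}_0$: fix a finite set $\mathcal{B}$ of base types; types are $\mathcal{T}::= o\mid \beta\mid \beta\to\tau$ ($\beta\in\mathcal{B}$). For each type $\tau$: a countable set $V_\tau$ of variables (unique type per variable) and a countable set $\Sigma_\tau$ of constants. Terms: variables, constants, applications $t\,s$ with $t\in T_{\sigma\to\tau}$, $s\in T_\sigma$, $\sigma\in\mathcal{B}$; formulas also include $\varphi\supset\psi$ and $\forall x.\varphi$ for $x\in V_\tau$, $\tau\in\mathcal{B}\cup\{o\}$. $\mathcal{I}_0$: terms are type-free $\lambda$-terms over a constant set $\Sigma$ containing $\Xi$, $L$, $A_\tau$ for $\tau\in\mathcal{B}$, and all constants in every $\Sigma_\tau$; all $\mathrm{PRED2}_0$ variables are variables of $\mathcal{I}_0$. Abbreviations: $K\equiv\lambda xy.x$, $H\equiv\lambda x.L(Kx)$, $F\equiv\lambda xyf.\Xi x(\lambda z.y(fz))$. Judgements $\Gamma\vdash t$ ($\Gamma$ finite); axioms $\Gamma,t\vdash t$; $\Gamma\vdash LH$; $\Gamma\vdash LA_\tau$ ($\tau\in\mathcal{B}$); rules: from $\Gamma\vdash t_1$, $t_1=_{\beta\eta}t_2$ infer $\Gamma\vdash t_2$; from $\Gamma\vdash t$ infer $\Gamma\vdash Ht$; from $\Gamma\vdash\Xi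 t_1t_2$, $\Gamma\vdash t_1t_3$ infer $\Gamma\vdash t_2t_3$; from $\Gamma,t_1x\vdash t_2x$, $\Gamma\vdash Lt_1$ infer $\Gamma\vdash\Xi t_1t_2$; from $\Gamma,t_1x\vdash H(t_2x)$, $\Gamma\vdash Lt_1$ infer $\Gamma\vdash H(\Xi t_1t_2)$; $x$ not free in $\Gamma,t_1,t_2$ in the last two. For arbitrary $\Gamma$, $\Gamma\vdash_{\mathcal{I}_0}t$ means derivable from some finite subset of $\Gamma$. Set $A_o\equiv H$ and $A_{\tau_1\to\tau_2}\equiv FA_{\tau_1}A_{\tau_2}$. For a finite set $\Delta$ of formulas, $\Gamma(\Delta)$ consists of: $A_\tau x$ for every variable $x\in V_\tau$ free in $\Delta$; $A_\tau c$ for every type $\tau$ and every $c\in\Sigma_\tau$; $LA_\tau$ for every $\tau\in\mathcal{B}$; and for every $\tau\in\mathcal{B}$, $A_\tau y$ for some chosen variable $y\in V_\tau$ not free in $\Delta$. -}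

module Defs where

open import Data.Nat using (ℕ; zero; suc)
open import Data.Fin using (Fin; zero; suc; #_)
open import Data.Product using (Σ; _×_; _,_)
open import Data.List using (List; []; _∷_)
open import Data.List.Relation.Unary.All using (All)
open import Data.List.Relation.Unary.Any using (Any)
open import Data.List.Membership.Propositional using (_∈_)
open import Relation.Binary.PropositionalEquality using (_≡_; _≢_)
open import Relation.Binary.Construct.Closure.Equivalence using (EqClosure)

data Ty (nB : ℕ) : Set where
  o    : Ty nB
  base : Fin nB → Ty nB
  _⇒_  : Fin nB → Ty nB → Ty nB

-- Everything else is parameterised by the base types and by the
-- family of constant sets Σ_τ = Con τ.
module PRED2 (nB : ℕ) (Con : Ty nB → Set) where

  -- A variable is a pair (τ , i): the i-th variable of V_τ.
  -- (V_τ is countably infinite; each variable has a unique type.)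
  Var : Set
  Var = Ty nB × ℕ

  data PTm : Ty nB → Set where
    pvar : ∀ {τ} → ℕ → PTm τ                       -- the variable (τ , i)
    pcon : ∀ {τ} → Con τ → PTm τ
    papp : ∀ {b τ} → PTm (b ⇒ τ) → PTm (base b) → PTm τ

  data QTy : Ty nB → Set where
    qo : QTy o
    qb : ∀ b → QTy (base b)

  data Form : Set where
    atom : PTm o → Form
    _⊃_  : Form → Form → Form
    all  : (τ : Ty nB) → QTy τ → ℕ → Form → Form

  data FreeT (x : Var) : ∀ {τ} → PTm τ → Set where
    fvar : ∀ {τ i} → x ≡ (τ , i) → FreeT x (pvar {τ} i)
    fapl : ∀ {b τ} {t : PTm (b ⇒ τ)} {s} → FreeT x t → FreeT x (papp t s)
    fapr : ∀ {b τ} {t : PTm (b ⇒ τ)} {s} → FreeT x s → FreeT x (papp t s)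

  data FreeF (x : Var) : Form → Set where
    fatom : ∀ {t} → FreeT x t → FreeF x (atom t)
    fimpl : ∀ {φ ψ} → FreeF x φ → FreeF x (φ ⊃ ψ)
    fimpr : ∀ {φ ψ} → FreeF x ψ → FreeF x (φ ⊃ ψ)
    fall  : ∀ {τ q i φ} → FreeF x φ → x ≢ (τ , i) → FreeF x (all τ q i φ)

  FreeIn : Var → List Form → Set
  FreeIn x Δ = Any (FreeF x) Δ

  -- I_0: type-free λ-terms (well-scoped de Bruijn for bound
  -- variables, named free variables = the PRED2_0 variables)

  data Const : Set where
    Ξ   : Const
    L   : Const
    Ab  : Fin nB → Const
    sig : (τ : Ty nB) → Con τ → Const

  infixl 9 _·_
  data Tm (n : ℕ) : Set where
    var : Var → Tm n
    bv  : Fin n → Tm n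
    con : Const → Tm n
    _·_ : Tm n → Tm n → Tm n
    ƛ   : Tm (suc n) → Tm n

  ext : ∀ {m n} → (Fin m → Fin n) → Fin (suc m) → Fin (suc n)
  ext ρ zero    = zero
  ext ρ (suc i) = suc (ρ i)

  rename : ∀ {m n} → (Fin m → Fin n) → Tm m → Tm n
  rename ρ (var x) = var x
  rename ρ (bv i)  = bv (ρ i)
  rename ρ (con c) = con c
  rename ρ (t · s) = rename ρ t · rename ρ s
  rename ρ (ƛ t)   = ƛ (rename (ext ρ) t)

  exts : ∀ {m n} → (Fin m → Tm n) → Fin (suc m) → Tm (suc n)
  exts σ zero    = bv zero
  exts σ (suc i) = rename suc (σ i)

  subst : ∀ {m n} → (Fin m → Tm n) → Tm m → Tm n
  subst σ (var x) = var x
  subst σ (bv i)  = σ i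
  subst σ (con c) = con c
  subst σ (t · s) = subst σ t · subst σ s
  subst σ (ƛ t)   = ƛ (subst (exts σ) t)

  sub0 : ∀ {n} → Tm n → Fin (suc n) → Tm n
  sub0 s zero    = s
  sub0 s (suc i) = bv i

  _[_] : ∀ {n} → Tm (suc n) → Tm n → Tm n
  t [ s ] = subst (sub0 s) t

  data _⟶_ : ∀ {n} → Tm n → Tm n → Set where
    β  : ∀ {n} (t : Tm (suc n)) (s : Tm n) → (ƛ t · s) ⟶ (t [ s ])
    η  : ∀ {n} (t : Tm n) → ƛ (rename suc t · bv zero) ⟶ t
    ξl : ∀ {n} {t t' s : Tm n} → t ⟶ t' → (t · s) ⟶ (t' · s)
    ξr : ∀ {n} {t s s' : Tm n} → s ⟶ s' → (t · s) ⟶ (t · s')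
    ξƛ : ∀ {n} {t t' : Tm (suc n)} → t ⟶ t' → ƛ t ⟶ ƛ t'

  _=βη_ : ∀ {n} → Tm n → Tm n → Set
  _=βη_ {n} = EqClosure (_⟶_ {n})

  data _∉FV_ (x : Var) : ∀ {n} → Tm n → Set where
    nvar : ∀ {n y} → x ≢ y → x ∉FV (var {n} y)
    nbv  : ∀ {n} {i : Fin n} → x ∉FV bv i
    ncon : ∀ {n c} → x ∉FV (con {n} c)
    napp : ∀ {n} {t s : Tm n} → x ∉FV t → x ∉FV s → x ∉FV (t · s)
    nlam : ∀ {n} {t : Tm (suc n)} → x ∉FV t → x ∉FV ƛ t

  K : ∀ {n} → Tm n
  K = ƛ (ƛ (bv (# 1)))

  H : Tm 0
  H = ƛ (con L · (K · bv zero))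

  -- F ≡ λ x y f. Ξ x (λ z. y (f z))
  F : Tm 0
  F = ƛ (ƛ (ƛ (con Ξ · bv (# 2) · ƛ (bv (# 2) · (bv (# 1) · bv (# 0))))))

  A : Ty nB → Tm 0
  A o       = H
  A (base b) = con (Ab b)
  A (b ⇒ τ) = F · A (base b) · A τ

  -- Judgements Γ ⊢ t of I_0 (Γ a finite set, represented by a list)
  infix 4 _⊢_
  data _⊢_ : List (Tm 0) → Tm 0 → Set where
    ax   : ∀ {Γ t} → t ∈ Γ → Γ ⊢ t
    LH   : ∀ {Γ} → Γ ⊢ con L · H
    LA   : ∀ {Γ} b → Γ ⊢ con L · con (Ab b)
    conv : ∀ {Γ t₁ t₂} → Γ ⊢ t₁ → t₁ =βη t₂ → Γ ⊢ t₂
    Hi   : ∀ {Γ t} → Γ ⊢ t → Γ ⊢ H · t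
    Ξe   : ∀ {Γ t₁ t₂ t₃} → Γ ⊢ con Ξ · t₁ · t₂ → Γ ⊢ t₁ · t₃ → Γ ⊢ t₂ · t₃
    Ξi   : ∀ {Γ t₁ t₂} (x : Var) → All (x ∉FV_) Γ → x ∉FV t₁ → x ∉FV t₂ →
           ((t₁ · var x) ∷ Γ) ⊢ t₂ · var x → Γ ⊢ con L · t₁ →
           Γ ⊢ con Ξ · t₁ · t₂
    HΞi  : ∀ {Γ t₁ t₂} (x : Var) → All (x ∉FV_) Γ → x ∉FV t₁ → x ∉FV t₂ →
           ((t₁ · var x) ∷ Γ) ⊢ H · (t₂ · var x) → Γ ⊢ con L · t₁ →
           Γ ⊢ H · (con Ξ · t₁ · t₂)

  -- Derivability from an arbitrary (possibly infinite) set Γ: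
  -- from some finite subset of Γ.
  _⊢I₀_ : (Tm 0 → Set) → Tm 0 → Set
  Γ ⊢I₀ t = Σ (List (Tm 0)) (λ Γ₀ → All Γ Γ₀ × (Γ₀ ⊢ t))

  -- Γ(Δ), for a chosen family y of variables y_β ∈ V_β
  -- (the freshness of y w.r.t. Δ is a hypothesis of the theorem).
  data GammaΔ (Δ : List Form) (y : Fin nB → ℕ) : Tm 0 → Set where
    gvar : ∀ τ i → FreeIn (τ , i) Δ → GammaΔ Δ y (A τ · var (τ , i))
    gcon : ∀ τ (c : Con τ) → GammaΔ Δ y (A τ · con (sig τ c))
    gL   : ∀ b → GammaΔ Δ y (con L · A (base b))
    gy   : ∀ b → GammaΔ Δ y (A (base b) · var (base b , y b))

module Submission where

-- The inhabitant of τ is built by recursion on τ: for o it is L H (since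
-- Γ ⊢ L H, the H-introduction rule gives Γ ⊢ H (L H) = A_o (L H)); for a
-- base type β it is the chosen variable y_β, whose typing A_β y_β is an
-- axiom of Γ(Δ); for β → τ it is the constant function λz. t_τ.  For the
-- arrow case, A_{β→τ} (λz. t_τ) = F A_β A_τ (λz. t_τ) β-reduces to
-- Ξ A_β (λz. A_τ t_τ) (lemma F-unfolds), which follows by Ξ-introduction
-- from the induction hypothesis A_τ t_τ in the context extended by A_β x,
-- for a variable x fresh for the context.

open import Defs
open import Data.Nat using (ℕ; suc; _≤_)
open import Data.Nat.Properties using (≤-refl; ≤-trans; n≤1+n; 1+n≰n)
open import Data.Fin using (Fin)
open import Data.Product using (Σ; _,_)
open import Data.List using (List; _∷_; map; allFin)
open import Data.List.Relation.Unary.All as All using (All; _∷_)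
open import Data.List.Relation.Unary.Any using (there)
open import Data.List.Membership.Propositional using (_∈_)
open import Data.List.Membership.Propositional.Properties using (∈-map⁺; ∈-map⁻; ∈-allFin)
open import Relation.Nullary using (¬_)
open import Relation.Binary.PropositionalEquality using (_≡_; refl; sym; trans; cong; cong₂)
open import Function.Definitions using (Injective)
open import Relation.Binary.Construct.Closure.Symmetric using (bwd)
open import Relation.Binary.Construct.Closure.ReflexiveTransitive using (ε; _◅_)

module Inhabitation (nB : ℕ) (Con : Ty nB → Set) where
  open PRED2 nB Con

  subst-cong : ∀ {m n} {σ σ' : Fin m → Tm n} → (∀ i → σ i ≡ σ' i) →
               ∀ t → subst σ t ≡ subst σ' t
  subst-cong e (var x) = refl
  subst-cong e (bv i)  = e i
  subst-cong e (con c) = refl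
  subst-cong e (t · s) = cong₂ _·_ (subst-cong e t) (subst-cong e s)
  subst-cong {σ = σ} {σ'} e (ƛ t) = cong ƛ (subst-cong exts-eq t)
    where exts-eq : ∀ i → exts σ i ≡ exts σ' i
          exts-eq Fin.zero    = refl
          exts-eq (Fin.suc i) = cong (rename Fin.suc) (e i)

  subst-rename : ∀ {m n k} (σ : Fin n → Tm k) (ρ : Fin m → Fin n) t →
                 subst σ (rename ρ t) ≡ subst (λ i → σ (ρ i)) t
  subst-rename σ ρ (var x) = refl
  subst-rename σ ρ (bv i)  = refl
  subst-rename σ ρ (con c) = refl
  subst-rename σ ρ (t · s) = cong₂ _·_ (subst-rename σ ρ t) (subst-rename σ ρ s)
  subst-rename σ ρ (ƛ t) =
    cong ƛ (trans (subst-rename (exts σ) (ext ρ) t) (subst-cong exts-ext t))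
    where exts-ext : ∀ i → exts σ (ext ρ i) ≡ exts (λ i → σ (ρ i)) i
          exts-ext Fin.zero    = refl
          exts-ext (Fin.suc i) = refl

  subst-id : ∀ {m} (σ : Fin m → Tm m) → (∀ i → σ i ≡ bv i) → ∀ t → subst σ t ≡ t
  subst-id σ e (var x) = refl
  subst-id σ e (bv i)  = e i
  subst-id σ e (con c) = refl
  subst-id σ e (t · s) = cong₂ _·_ (subst-id σ e t) (subst-id σ e s)
  subst-id σ e (ƛ t) = cong ƛ (subst-id (exts σ) exts-id t)
    where exts-id : ∀ i → exts σ i ≡ bv i
          exts-id Fin.zero    = refl
          exts-id (Fin.suc i) = cong (rename Fin.suc) (e i)

  rename-as-subst : ∀ {m n} (ρ : Fin m → Fin n) t → rename ρ t ≡ subst (λ i → bv (ρ i)) t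
  rename-as-subst ρ (var x) = refl
  rename-as-subst ρ (bv i)  = refl
  rename-as-subst ρ (con c) = refl
  rename-as-subst ρ (t · s) = cong₂ _·_ (rename-as-subst ρ t) (rename-as-subst ρ s)
  rename-as-subst ρ (ƛ t) =
    cong ƛ (trans (rename-as-subst (ext ρ) t) (subst-cong bv-ext t))
    where bv-ext : ∀ i → bv (ext ρ i) ≡ exts (λ i → bv (ρ i)) i
          bv-ext Fin.zero    = refl
          bv-ext (Fin.suc i) = refl

  instantiate-weaken : ∀ {n} (u v : Tm n) → (rename Fin.suc v) [ u ] ≡ v
  instantiate-weaken u v =
    trans (subst-rename (sub0 u) Fin.suc v) (subst-id _ (λ i → refl) v)

  closed-subst-weaken : ∀ {m n k} (σ : Fin n → Tm k) (ρ₁ : Fin m → Fin n)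
                        (ρ₀ : Fin 0 → Fin m) (ρ : Fin 0 → Fin k) (t : Tm 0) →
                        subst σ (rename ρ₁ (rename ρ₀ t)) ≡ rename ρ t
  closed-subst-weaken σ ρ₁ ρ₀ ρ t =
    trans (subst-rename σ ρ₁ (rename ρ₀ t))
      (trans (subst-rename _ ρ₀ t)
        (trans (subst-cong (λ ()) t) (sym (rename-as-subst ρ t))))

  β≡ : ∀ {n} {t : Tm (suc n)} {s u : Tm n} → (t [ s ]) ≡ u → (ƛ t · s) ⟶ u
  β≡ {t = t} {s} refl = β t s

  expand : ∀ {Γ t u} → Γ ⊢ u → t ⟶ u → Γ ⊢ t
  expand d step = conv d (bwd step ◅ ε)

  -- F c B s ⟶* Ξ c (λz. B (s z)) for closed B and s, by three β-steps; in
  -- the last contractum only the twice-weakened B needs simplifying.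
  F-unfolds : ∀ {Γ} c (B s : Tm 0) →
              Γ ⊢ con Ξ · con c · ƛ (rename Fin.suc B · (rename Fin.suc s · bv Fin.zero)) →
              Γ ⊢ F · con c · B · s
  F-unfolds c B s d = expand (expand (expand d (β≡ contractum)) (ξl (β _ _))) (ξl (ξl (β _ _)))
    where
      contractum : (con Ξ · con c · ƛ (rename Fin.suc (rename Fin.suc B) · (bv (Fin.suc Fin.zero) · bv Fin.zero))) [ s ]
                   ≡ con Ξ · con c · ƛ (rename Fin.suc B · (rename Fin.suc s · bv Fin.zero))
      contractum = cong (λ (B' : Tm 1) → con Ξ · con c · ƛ (B' · (rename Fin.suc s · bv Fin.zero)))
                        (closed-subst-weaken _ Fin.suc Fin.suc Fin.suc B)

  rename-fresh : ∀ {x m n} (ρ : Fin m → Fin n) {t} → x ∉FV t → x ∉FV rename ρ t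
  rename-fresh ρ (nvar p)   = nvar p
  rename-fresh ρ nbv        = nbv
  rename-fresh ρ ncon       = ncon
  rename-fresh ρ (napp p q) = napp (rename-fresh ρ p) (rename-fresh ρ q)
  rename-fresh ρ (nlam p)   = nlam (rename-fresh (ext ρ) p)

  A-closed : ∀ x τ → x ∉FV A τ
  A-closed x o        = nlam (napp ncon (napp (nlam (nlam nbv)) nbv))
  A-closed x (base b) = ncon
  A-closed x (b ⇒ τ)  =
    napp (napp (nlam (nlam (nlam (napp (napp ncon nbv) (nlam (napp nbv (napp nbv nbv)))))))
               ncon)
         (A-closed x τ)

  -- u contains no variable (o , k) with k ≥ n; such variables serve as
  -- the fresh variables of Ξ-introduction.
  FreshAbove : ℕ → Tm 0 → Set
  FreshAbove n u = ∀ k → n ≤ k → (o , k) ∉FV u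

  module Witness (y : Fin nB → ℕ) where

    inhabitant : Ty nB → Tm 0
    inhabitant o        = con L · H
    inhabitant (base b) = var (base b , y b)
    inhabitant (b ⇒ τ)  = ƛ (rename Fin.suc (inhabitant τ))

    inhabitant-fresh : ∀ k τ → (o , k) ∉FV inhabitant τ
    inhabitant-fresh k o        = napp ncon (A-closed (o , k) o)
    inhabitant-fresh k (base b) = nvar (λ ())
    inhabitant-fresh k (b ⇒ τ)  = nlam (rename-fresh Fin.suc (inhabitant-fresh k τ))

    yAxiom : Fin nB → Tm 0
    yAxiom b = A (base b) · var (base b , y b)

    yAxiom-fresh : ∀ b → FreshAbove 0 (yAxiom b)
    yAxiom-fresh b k _ = napp ncon (nvar (λ ()))

    -- The bound n is raised
    -- past the fresh variable introduced in the arrow case.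
    inhabited : ∀ τ n Γ → (∀ b → yAxiom b ∈ Γ) → All (FreshAbove n) Γ →
                Γ ⊢ A τ · inhabitant τ
    inhabited o        n Γ hasY fresh = Hi LH
    inhabited (base b) n Γ hasY fresh = ax (hasY b)
    inhabited (b ⇒ τ)  n Γ hasY fresh =
      F-unfolds (Ab b) (A τ) t
        (Ξi x (All.map (λ f → f n ≤-refl) fresh) ncon body-fresh body-at-x (LA b))
      where
        t₀ t : Tm 0
        t₀ = inhabitant τ
        t  = inhabitant (b ⇒ τ)

        x : Var
        x = (o , n)

        body : Tm 0
        body = ƛ (rename Fin.suc (A τ) · (rename Fin.suc t · bv Fin.zero))

        body-fresh : x ∉FV body
        body-fresh = nlam (napp (rename-fresh Fin.suc (A-closed x τ))
                                (napp (rename-fresh Fin.suc (inhabitant-fresh n (b ⇒ τ))) nbv))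

        Γ' : List (Tm 0)
        Γ' = (con (Ab b) · var x) ∷ Γ

        fresh' : All (FreshAbove (suc n)) Γ'
        fresh' = (λ k n<k → napp ncon (nvar (λ { refl → 1+n≰n n<k })))
               ∷ All.map (λ f k n<k → f k (≤-trans (n≤1+n n) n<k)) fresh

        IH : Γ' ⊢ A τ · t₀
        IH = inhabited τ (suc n) Γ' (λ b → there (hasY b)) fresh'

        -- body x ⟶ A_τ (t x) ⟶ A_τ t₀, the induction hypothesis
        body-at-x : Γ' ⊢ body · var x
        body-at-x = expand (expand IH (ξr (β≡ (instantiate-weaken (var x) t₀))))
                           (β≡ (cong₂ _·_ (instantiate-weaken (var x) (A τ))
                                          (cong (_· var x) (instantiate-weaken (var x) t))))

    yContext : List (Tm 0)
    yContext = map yAxiom (allFin nB)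

    yContext-complete : ∀ b → yAxiom b ∈ yContext
    yContext-complete b = ∈-map⁺ yAxiom (∈-allFin b)

    yContext-all : ∀ {P : Tm 0 → Set} → (∀ b → P (yAxiom b)) → All P yContext
    yContext-all {P} f = All.tabulate member
      where member : ∀ {u} → u ∈ yContext → P u
            member u∈ with ∈-map⁻ yAxiom u∈
            ... | b , _ , refl = f b

mainTheorem7 : (nB : ℕ) (Con : Ty nB → Set) →
    (∀ τ → Σ (Con τ → ℕ) (λ f → Injective _≡_ _≡_ f)) →
    let open PRED2 nB Con in
    (τ : Ty nB) (Δ : List Form) (y : Fin nB → ℕ) →
    (∀ b → ¬ FreeIn (base b , y b) Δ) →
    Σ (Tm 0) (λ t → GammaΔ Δ y ⊢I₀ (A τ · t))
mainTheorem7 nB Con _ τ Δ y _ =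
  inhabitant τ , yContext , yContext-all (PRED2.gy {Δ = Δ}) ,
  inhabited τ 0 yContext yContext-complete (yContext-all yAxiom-fresh)
  where
    open Inhabitation nB Con
    open Witness y
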